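{- Let $G$ be a ribbon graph, $A\subseteq E(G)$, and $n$ a positive integer. Then $f_n(G)=f_n(G^{\delta(A)})$. In particular, $\kappa(G)=\kappa(G^{\delta(A)})$.
   Context: A ribbon graph $G=(V,E)$ is a surface with boundary formed by a set $V$ of vertex discs and a set $E$ of edge discs (ribbons), such that vertices and edges meet in disjoint line segments, each lying on the boundary of exactly one vertex and exactly one edge, and each edge contains exactly two such segments. For $F\subseteq E$, $(V,F)$ is the spanning ribbon subgraph obtained by deleting the edges not in $F$. $f_n(G)$ is the number of $F\subseteq E$ such that $(V,F)$ has exactly $n$ boundary components; $\kappa(G)=f_1(G)$. Partial dual $G^{\delta(A)}$: glue a disc along each boundary component of $(V,A)$ (these are the new vertices), remove the interiors of the old vertex discs, and keep the edge ribbons unchanged. -}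

module Defs where

open import Data.Nat using (ℕ; zero; suc; _+_; _*_; _<ᵇ_; _≡ᵇ_)
open import Data.Bool using (Bool; true; false; not; _∧_; _∨_; if_then_else_)
import Data.Bool as B
open import Data.Bool.Properties using (not-involutive)
open import Data.Fin using (Fin; toℕ)
import Data.Fin as F
open import Data.Fin.Subset using (Subset)
open import Data.Vec using (Vec; []; _∷_; lookup)
open import Data.List using (List; []; _∷_; length; filterᵇ; concatMap; allFin; map)
open import Data.Bool.ListAction using (any)
open import Data.Product using (_×_; _,_; proj₁)
open import Data.Product.Properties using (≡-dec)
open import Relation.Nullary using (does; ¬_)
open import Relation.Binary.PropositionalEquality using (_≡_; refl; cong; sym; trans)

-- Each edge ribbon e is a rectangle; its two attaching
-- segments ("ends") are indexed by s : Bool and its two long sides by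
-- c : Bool.  A corner is (e , s , c): the endpoint of end s of e lying on
-- long side c.  Long side c joins (e,false,c) to (e,true,c); end s joins
-- (e,s,false) to (e,s,true).
--
-- The vertex circles are described by the "gap arcs": the arcs of the
-- vertex boundaries between consecutive attaching segments.  Each corner
-- is an endpoint of exactly one gap arc, so the gap arcs form a
-- fixed-point-free involution α on corners.  Vertices carrying no edge
-- (isolated vertices) are counted separately by `isolated`.

Corner : ℕ → Set
Corner m = Fin m × Bool × Bool

record RibbonGraph : Set where
  field
    edges    : ℕ
    isolated : ℕ
    α        : Corner edges → Corner edges
    α-invol  : ∀ p → α (α p) ≡ p
    α-fpf    : ∀ p → ¬ (α p ≡ p)

open RibbonGraph public

Edge : RibbonGraph → Set
Edge G = Fin (edges G)

EdgeSet : RibbonGraph → Set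
EdgeSet G = Subset (edges G)

_∈ᵇ_ : ∀ {m} → Fin m → Subset m → Bool
e ∈ᵇ A = lookup A e

-- Boundary of the spanning ribbon subgraph (V,F): its pieces are the gap
-- arcs (α), the attaching segments of edges not in F, and the long sides
-- of edges in F.  β F pairs each corner with the other end of the piece
-- (segment or long side) at that corner.

β : ∀ {m} → Subset m → Corner m → Corner m
β F (e , s , c) = if e ∈ᵇ F then (e , not s , c) else (e , s , not c)

_≟c_ : ∀ {m} (p q : Corner m) → Relation.Nullary.Dec (p ≡ q)
_≟c_ = ≡-dec F._≟_ (≡-dec B._≟_ B._≟_)

allCorners : (m : ℕ) → List (Corner m)
allCorners m = concatMap (λ e → (e , false , false) ∷ (e , false , true)
                              ∷ (e , true , false) ∷ (e , true , true) ∷ [])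
                         (allFin m)

b2n : Bool → ℕ
b2n false = 0
b2n true  = 1

rank : ∀ {m} → Corner m → ℕ
rank (e , s , c) = 4 * toℕ e + 2 * b2n s + b2n c

reach : (G : RibbonGraph) → Subset (edges G) → Corner (edges G) → ℕ →
        Corner (edges G) → Bool
reach G F p zero    q = does (q ≟c p)
reach G F p (suc j) q = reach G F p j q ∨ reach G F p j (α G q)
                        ∨ reach G F p j (β F q)

isRep : (G : RibbonGraph) → Subset (edges G) → Corner (edges G) → Bool
isRep G F p = not (any (λ q → reach G F p (4 * edges G) q ∧ (rank q <ᵇ rank p))
                       (allCorners (edges G)))

bc : (G : RibbonGraph) → Subset (edges G) → ℕ
bc G F = isolated G + length (filterᵇ (isRep G F) (allCorners (edges G)))

allSubsets : (m : ℕ) → List (Subset m)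
allSubsets zero    = [] ∷ []
allSubsets (suc m) = concatMap (λ A → (false ∷ A) ∷ (true ∷ A) ∷ []) (allSubsets m)

f : ℕ → RibbonGraph → ℕ
f n G = length (filterᵇ (λ F → bc G F ≡ᵇ n) (allSubsets (edges G)))

κ : RibbonGraph → ℕ
κ G = f 1 G

-- The new vertices are the boundary cycles of (V,A);
-- for e ∈ A the ribbon now attaches along its long sides, so the roles of
-- s and c are exchanged (relabelling π A); the gap arcs are unchanged.

π : ∀ {m} → Subset m → Corner m → Corner m
π A (e , s , c) = if e ∈ᵇ A then (e , c , s) else (e , s , c)

π-invol : ∀ {m} (A : Subset m) p → π A (π A p) ≡ p
π-invol A (e , s , c) with e ∈ᵇ A in eq
... | true  rewrite eq = refl
... | false rewrite eq = refl

partialDual : (G : RibbonGraph) → Subset (edges G) → RibbonGraph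
partialDual G A = record
  { edges    = edges G
  ; isolated = isolated G
  ; α        = λ p → π A (α G (π A p))
  ; α-invol  = λ p → trans (cong (λ x → π A (α G x)) (π-invol A (α G (π A p))))
                     (trans (cong (π A) (α-invol G (π A p))) (π-invol A p))
  ; α-fpf    = λ p eq → α-fpf G (π A p)
                     (trans (sym (π-invol A (α G (π A p)))) (cong (π A) eq))
  }

_^δ_ : (G : RibbonGraph) → Subset (edges G) → RibbonGraph
G ^δ A = partialDual G A

{-# OPTIONS --safe #-}
-- Let π A relabel the corners so that, on each ribbon of A, long sides and
-- attaching segments exchange roles.  It carries the gap arcs of G to those of
-- G^δ(A) and the boundary pieces of (V, F) in G to those of (V, F ∆ A) in
-- G^δ(A), so the boundary cycles correspond and bc G F = bc (G^δ A) (F ∆ A);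
-- as F ↦ F ∆ A permutes the edge subsets, f_n G = f_n (G^δ A) for every n.
-- The catch is that bc counts each cycle through its corner of least rank,
-- which π A does not preserve.  But every injective ranking picks exactly one
-- corner per cycle, so double counting pairs of cycle-mates shows that the
-- number of minimal corners does not depend on the ranking.
module Submission where

open import Defs
open import Data.Bool as Bool using (Bool; true; false; not; T; _∧_; _∨_; _xor_)
open import Data.Bool.ListAction using (any)
open import Data.Bool.Properties
  using (T-∧; T-∨; ∧-comm; not-involutive; xor-assoc; xor-same; xor-identityʳ)
open import Data.Empty using (⊥-elim)
open import Data.Fin using (Fin; zero; suc; toℕ; combine)
open import Data.Fin.Subset using (Subset)
open import Data.Fin.Properties using (toℕ-injective; toℕ-combine; combine-injective)
open import Data.List
  using (List; []; _∷_; _++_; length; map; filterᵇ; concatMap; cartesianProductWith; cartesianProduct; allFin)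
open import Data.List.Properties using (length-tabulate)
open import Data.List.Membership.Propositional using (_∈_)
open import Data.List.Membership.Propositional.Properties
  using (∈-allFin; ∈-cartesianProductWith⁺)
open import Data.List.Relation.Unary.All as All using ()
open import Data.List.Relation.Unary.Any as Any using (here; there; satisfied)
open import Data.List.Relation.Unary.Any.Properties using (any⁺; any⁻)
open import Data.List.Relation.Unary.Unique.Propositional using (Unique; []; _∷_)
open import Data.List.Relation.Unary.Unique.Propositional.Properties
  using (cartesianProductWith⁺; allFin⁺)
open import Data.Nat using (ℕ; zero; suc; _+_; _*_; _≤_; _<_; _<ᵇ_; _≡ᵇ_; s≤s; s≤s⁻¹)
open import Data.Nat.Induction using (<-wellFounded)
open import Data.Nat.Properties
open import Algebra.Properties.CommutativeSemigroup +-commutativeSemigroup using (interchange)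
open import Data.Product using (_×_; _,_; proj₂; ∃-syntax; ∃₂)
open import Data.Product.Properties using (,-injective)
open import Data.Vec using ([]; _∷_; zipWith)
open import Data.Vec.Properties as Vec using (∷-injective; lookup-zipWith)
open import Data.Sum using (_⊎_; inj₁; inj₂)
open import Function using (_∘_; Injective)
open import Function.Bundles using (Equivalence)
open import Induction.WellFounded using (Acc; acc)
open import Relation.Binary.Definitions using (DecidableEquality)
open import Relation.Binary.PropositionalEquality
open import Relation.Nullary using (Dec; yes; no; does; ¬_)

open Equivalence using (to; from)

private
  variable
    X Y Z : Set

T-⇔⇒≡ : ∀ {a b} → (T a → T b) → (T b → T a) → a ≡ b
T-⇔⇒≡ {false} {false} _ _ = refl
T-⇔⇒≡ {false} {true}  _ b⇒a = ⊥-elim (b⇒a _)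
T-⇔⇒≡ {true}  {false} a⇒b _ = ⊥-elim (a⇒b _)
T-⇔⇒≡ {true}  {true}  _ _ = refl

T-does⁺ : ∀ {P : Set} (d : Dec P) → P → T (does d)
T-does⁺ (yes _) _ = _
T-does⁺ (no ¬p) p = ¬p p

T-does⁻ : ∀ {P : Set} (d : Dec P) → T (does d) → P
T-does⁻ (yes p) _ = p

T-∨ˡ : ∀ a {b} → T a → T (a ∨ b)
T-∨ˡ true _ = _

T-∨ʳ : ∀ a {b} → T b → T (a ∨ b)
T-∨ʳ true  _  = _
T-∨ʳ false tb = tb

T-not⇒¬T : ∀ {b} → T (not b) → ¬ T b
T-not⇒¬T {false} _ ()

sumOver : (X → ℕ) → List X → ℕ
sumOver h []       = 0
sumOver h (x ∷ xs) = h x + sumOver h xs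

count : (X → Bool) → List X → ℕ
count g = sumOver (λ x → b2n (g x))

sumOver-cong : ∀ {h k : X → ℕ} xs → (∀ x → h x ≡ k x) → sumOver h xs ≡ sumOver k xs
sumOver-cong []       h≡k = refl
sumOver-cong (x ∷ xs) h≡k = cong₂ _+_ (h≡k x) (sumOver-cong xs h≡k)

count-cong : ∀ {g h : X → Bool} xs → (∀ x → g x ≡ h x) → count g xs ≡ count h xs
count-cong xs g≡h = sumOver-cong xs (cong b2n ∘ g≡h)

sumOver-0 : (xs : List X) → sumOver (λ _ → 0) xs ≡ 0
sumOver-0 []       = refl
sumOver-0 (x ∷ xs) = sumOver-0 xs

sumOver-+ : ∀ (h k : X → ℕ) xs → sumOver (λ x → h x + k x) xs ≡ sumOver h xs + sumOver k xs
sumOver-+ h k []       = refl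
sumOver-+ h k (x ∷ xs) = trans (cong (h x + k x +_) (sumOver-+ h k xs)) (interchange (h x) (k x) _ _)

sumOver-comm : ∀ (h : X → Y → ℕ) xs ys →
  sumOver (λ x → sumOver (h x) ys) xs ≡ sumOver (λ y → sumOver (λ x → h x y) xs) ys
sumOver-comm h []       ys = sym (sumOver-0 ys)
sumOver-comm h (x ∷ xs) ys = begin
  sumOver (h x) ys + sumOver (λ x → sumOver (h x) ys) xs
    ≡⟨ cong (sumOver (h x) ys +_) (sumOver-comm h xs ys) ⟩
  sumOver (h x) ys + sumOver (λ y → sumOver (λ x → h x y) xs) ys
    ≡⟨ sumOver-+ (h x) (λ y → sumOver (λ x → h x y) xs) ys ⟨
  sumOver (λ y → h x y + sumOver (λ x → h x y) xs) ys ∎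
  where open ≡-Reasoning

length-filterᵇ : ∀ (g : X → Bool) xs → length (filterᵇ g xs) ≡ count g xs
length-filterᵇ g []       = refl
length-filterᵇ g (x ∷ xs) with g x
... | true  = cong suc (length-filterᵇ g xs)
... | false = length-filterᵇ g xs

count-≤-length : ∀ (g : X → Bool) xs → count g xs ≤ length xs
count-≤-length g []       = ≤-refl
count-≤-length g (x ∷ xs) with g x
... | true  = s≤s (count-≤-length g xs)
... | false = m≤n⇒m≤1+n (count-≤-length g xs)

count-mono : ∀ {g h : X → Bool} → (∀ {x} → T (g x) → T (h x)) →
  ∀ xs → count g xs ≤ count h xs
count-mono {g = g} {h} g⊆h []       = ≤-refl
count-mono {g = g} {h} g⊆h (x ∷ xs) with g x in gx | h x in hx
... | true  | true  = s≤s (count-mono g⊆h xs)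
... | false | true  = m≤n⇒m≤1+n (count-mono g⊆h xs)
... | false | false = count-mono g⊆h xs
... | true  | false = ⊥-elim (subst T hx (g⊆h (subst T (sym gx) _)))

count-reflects-⊆ : ∀ {g h : X → Bool} → (∀ {x} → T (g x) → T (h x)) →
  ∀ xs → count h xs ≤ count g xs → ∀ {x} → x ∈ xs → T (h x) → T (g x)
count-reflects-⊆ {g = g} {h} g⊆h (y ∷ ys) h≤g x∈xs hx with g y in gy | h y in hy
... | true  | true  = reflect x∈xs
  where
  reflect : _ ∈ y ∷ ys → T (g _)
  reflect (here refl) = subst T (sym gy) _
  reflect (there x∈ys) = count-reflects-⊆ g⊆h ys (s≤s⁻¹ h≤g) x∈ys hx
... | true  | false = ⊥-elim (subst T hy (g⊆h (subst T (sym gy) _)))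
... | false | true  = ⊥-elim (<-irrefl refl (≤-trans h≤g (count-mono g⊆h ys)))
... | false | false = reflect x∈xs
  where
  reflect : _ ∈ y ∷ ys → T (g _)
  reflect (here refl) = ⊥-elim (subst T hy hx)
  reflect (there x∈ys) = count-reflects-⊆ g⊆h ys h≤g x∈ys hx

count-none : ∀ {g : X → Bool} xs → (∀ {x} → x ∈ xs → ¬ T (g x)) → count g xs ≡ 0
count-none []       none = refl
count-none {g = g} (x ∷ xs) none with g x in gx
... | true  = ⊥-elim (none (here refl) (subst T (sym gx) _))
... | false = count-none xs (none ∘ there)

count-unique : ∀ {g : X → Bool} {xs x} → Unique xs → x ∈ xs → T (g x) →
  (∀ {y} → T (g y) → y ≡ x) → count g xs ≡ 1
count-unique {g = g} {y ∷ ys} (y∉ys ∷ _) (here refl) gx only with g y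
... | true = cong suc (count-none ys λ z∈ys gz → All.lookup y∉ys z∈ys (sym (only gz)))
count-unique {g = g} {y ∷ ys} (y∉ys ∷ u) (there x∈ys) gx only with g y in gy
... | true  = ⊥-elim (All.lookup y∉ys x∈ys (only (subst T (sym gy) _)))
... | false = count-unique u x∈ys gx only

count-∧ˡ : ∀ b (g : X → Bool) xs →
  (T b → count g xs ≡ 1) → count (λ x → b ∧ g x) xs ≡ b2n b
count-∧ˡ true  g xs one = one _
count-∧ˡ false g xs _   = sumOver-0 xs

count-matching : ∀ {P : X → Bool} {Q : Y → Bool} (S : X → Y → Bool) xs ys →
  (∀ {x} → T (P x) → count (λ y → Q y ∧ S x y) ys ≡ 1) →
  (∀ {y} → T (Q y) → count (λ x → P x ∧ S x y) xs ≡ 1) →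
  count P xs ≡ count Q ys
count-matching {P = P} {Q} S xs ys P-matched Q-matched = begin
  count P xs
    ≡⟨ sumOver-cong xs (λ x → count-∧ˡ (P x) _ ys P-matched) ⟨
  sumOver (λ x → count (λ y → P x ∧ (Q y ∧ S x y)) ys) xs
    ≡⟨ sumOver-comm (λ x y → b2n (P x ∧ (Q y ∧ S x y))) xs ys ⟩
  sumOver (λ y → count (λ x → P x ∧ (Q y ∧ S x y)) xs) ys
    ≡⟨ sumOver-cong ys (λ y → count-cong xs (λ x → ∧-swap (P x) (Q y) (S x y))) ⟩
  sumOver (λ y → count (λ x → Q y ∧ (P x ∧ S x y)) xs) ys
    ≡⟨ sumOver-cong ys (λ y → count-∧ˡ (Q y) _ xs Q-matched) ⟩
  count Q ys ∎
  where
  open ≡-Reasoning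
  ∧-swap : ∀ a b c → a ∧ (b ∧ c) ≡ b ∧ (a ∧ c)
  ∧-swap false b c = sym (∧-comm b false)
  ∧-swap true  b c = refl

any≡0<count : ∀ (g : X → Bool) xs → any g xs ≡ (0 <ᵇ count g xs)
any≡0<count g []       = refl
any≡0<count g (x ∷ xs) with g x
... | true  = refl
... | false = any≡0<count g xs

any-cong : ∀ {g h : X → Bool} xs → (∀ x → g x ≡ h x) → any g xs ≡ any h xs
any-cong []       g≡h = refl
any-cong (x ∷ xs) g≡h = cong₂ _∨_ (g≡h x) (any-cong xs g≡h)

record IsEnumeration (xs : List X) : Set where
  field
    unique   : Unique xs
    complete : ∀ x → x ∈ xs

module _ {xs : List X} (_≟_ : DecidableEquality X) (enum : IsEnumeration xs)
         (σ : X → X) (σ-involutive : ∀ x → σ (σ x) ≡ x) where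
  open IsEnumeration enum

  count-∘-involution : (g : X → Bool) → count (g ∘ σ) xs ≡ count g xs
  count-∘-involution g = count-matching (λ x y → does (y ≟ σ x)) xs xs σ-matched σ⁻¹-matched
    where
    σ-matched : ∀ {x} → T (g (σ x)) → count (λ y → g y ∧ does (y ≟ σ x)) xs ≡ 1
    σ-matched {x} gσx = count-unique unique (complete (σ x))
      (from T-∧ (gσx , T-does⁺ (σ x ≟ σ x) refl))
      (λ h → T-does⁻ (_ ≟ σ x) (proj₂ (to T-∧ h)))

    σ⁻¹-matched : ∀ {y} → T (g y) → count (λ x → g (σ x) ∧ does (y ≟ σ x)) xs ≡ 1
    σ⁻¹-matched {y} gy = count-unique unique (complete (σ y))
      (from T-∧ (subst (T ∘ g) y≡σσy gy , T-does⁺ (y ≟ σ (σ y)) y≡σσy))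
      (λ {x} h → trans (sym (σ-involutive x)) (cong σ (sym (T-does⁻ (y ≟ σ x) (proj₂ (to T-∧ h))))))
      where y≡σσy = sym (σ-involutive y)

  any-∘-involution : (g : X → Bool) → any (g ∘ σ) xs ≡ any g xs
  any-∘-involution g = begin
    any (g ∘ σ) xs            ≡⟨ any≡0<count (g ∘ σ) xs ⟩
    0 <ᵇ count (g ∘ σ) xs     ≡⟨ cong (0 <ᵇ_) (count-∘-involution g) ⟩
    0 <ᵇ count g xs           ≡⟨ any≡0<count g xs ⟨
    any g xs                  ∎
    where open ≡-Reasoning

cartesianProductWith-isEnumeration : ∀ {xs : List X} {ys : List Y} (f : X → Y → Z) →
  (∀ {w x y z} → f w y ≡ f x z → w ≡ x × y ≡ z) → (∀ z → ∃₂ λ x y → f x y ≡ z) →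
  IsEnumeration xs → IsEnumeration ys → IsEnumeration (cartesianProductWith f xs ys)
cartesianProductWith-isEnumeration {xs = xs} {ys} f f-injective f-surjective exs eys = record
  { unique   = cartesianProductWith⁺ f f-injective (unique exs) (unique eys)
  ; complete = complete′
  }
  where
  open IsEnumeration
  complete′ : ∀ z → z ∈ cartesianProductWith f xs ys
  complete′ z with f-surjective z
  ... | x , y , refl = ∈-cartesianProductWith⁺ f (complete exs x) (complete eys y)

module ClassMinima {xs : List X} (enum : IsEnumeration xs) (R : X → X → Bool)
    (R-refl  : ∀ x → T (R x x))
    (R-sym   : ∀ {x y} → T (R x y) → T (R y x))
    (R-trans : ∀ {x y z} → T (R x y) → T (R y z) → T (R x z)) where
  open IsEnumeration enum

  isClassMin : (X → ℕ) → X → Bool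
  isClassMin rk x = not (any (λ y → R x y ∧ (rk y <ᵇ rk x)) xs)

  classMin-≤ : ∀ rk {x y} → T (isClassMin rk x) → T (R x y) → rk x ≤ rk y
  classMin-≤ rk {x} {y} x-min xRy = ≮⇒≥ λ y<x → T-not⇒¬T x-min
    (any⁺ _ (Any.map (λ { refl → from T-∧ (xRy , <⇒<ᵇ y<x) }) (complete y)))

  classMin-exists : ∀ rk x → ∃[ y ] T (isClassMin rk y ∧ R x y)
  classMin-exists rk x = descend x (R-refl x) (<-wellFounded (rk x))
    where
    descend : ∀ y → T (R x y) → Acc _<_ (rk y) → ∃[ z ] T (isClassMin rk z ∧ R x z)
    descend y xRy (acc smaller) with any (λ z → R y z ∧ (rk z <ᵇ rk y)) xs in below
    ... | false = y , from T-∧ (subst (T ∘ not) (sym below) _ , xRy)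
    ... | true  with satisfied (any⁻ _ xs (subst T (sym below) _))
    ...   | z , yRz∧z<y with to T-∧ yRz∧z<y
    ...     | yRz , z<y = descend z (R-trans xRy yRz) (smaller (<ᵇ⇒< _ _ z<y))

  classMin-unique : ∀ {rk} → Injective _≡_ _≡_ rk → ∀ {y z} →
    T (isClassMin rk y) → T (isClassMin rk z) → T (R y z) → y ≡ z
  classMin-unique {rk} rk-injective y-min z-min yRz =
    rk-injective (≤-antisym (classMin-≤ rk y-min yRz) (classMin-≤ rk z-min (R-sym yRz)))

  count-classMin : ∀ {rk} → Injective _≡_ _≡_ rk →
    ∀ x → count (λ y → isClassMin rk y ∧ R x y) xs ≡ 1
  count-classMin {rk} rk-injective x with classMin-exists rk x
  ... | y , y-min∧xRy = count-unique unique (complete y) y-min∧xRy only-y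
    where
    only-y : ∀ {z} → T (isClassMin rk z ∧ R x z) → z ≡ y
    only-y z-min∧xRz with to T-∧ z-min∧xRz | to T-∧ y-min∧xRy
    ... | z-min , xRz | y-min , xRy = classMin-unique rk-injective z-min y-min (R-trans (R-sym xRz) xRy)

  -- Every class has exactly one minimum for each injective ranking, so the
  -- minima for two rankings are matched one-to-one by R.
  count-classMin-independent : ∀ {rk₁ rk₂} →
    Injective _≡_ _≡_ rk₁ → Injective _≡_ _≡_ rk₂ → count (isClassMin rk₁) xs ≡ count (isClassMin rk₂) xs
  count-classMin-independent {rk₁} rk₁-injective rk₂-injective =
    count-matching R xs xs (λ {x} _ → count-classMin rk₂-injective x) λ {y} _ →
      trans (count-cong xs (λ x → cong (isClassMin rk₁ x ∧_) (T-⇔⇒≡ R-sym R-sym)))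
            (count-classMin rk₁-injective y)

concatMap-map≡cartesianProductWith : ∀ (f : X → Y → Z) xs ys →
  concatMap (λ x → map (f x) ys) xs ≡ cartesianProductWith f xs ys
concatMap-map≡cartesianProductWith f []       ys = refl
concatMap-map≡cartesianProductWith f (x ∷ xs) ys =
  cong (map (f x) ys ++_) (concatMap-map≡cartesianProductWith f xs ys)

allFin-isEnumeration : ∀ m → IsEnumeration (allFin m)
allFin-isEnumeration m = record { unique = allFin⁺ m ; complete = ∈-allFin }

bools : List Bool
bools = false ∷ true ∷ []

bools-isEnumeration : IsEnumeration bools
bools-isEnumeration = record
  { unique   = ((λ ()) All.∷ All.[]) ∷ All.[] ∷ []
  ; complete = λ { false → here refl ; true → there (here refl) }
  }

bitPairs : List (Bool × Bool)
bitPairs = cartesianProduct bools bools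

cartesianProduct-isEnumeration : ∀ {xs : List X} {ys : List Y} →
  IsEnumeration xs → IsEnumeration ys → IsEnumeration (cartesianProduct xs ys)
cartesianProduct-isEnumeration =
  cartesianProductWith-isEnumeration _,_ ,-injective (λ { (x , y) → x , y , refl })

allCorners-isEnumeration : ∀ m → IsEnumeration (allCorners m)
allCorners-isEnumeration m =
  subst IsEnumeration (sym (concatMap-map≡cartesianProductWith _,_ (allFin m) bitPairs))
    (cartesianProduct-isEnumeration (allFin-isEnumeration m)
      (cartesianProduct-isEnumeration bools-isEnumeration bools-isEnumeration))

allSubsets-isEnumeration : ∀ m → IsEnumeration (allSubsets m)
allSubsets-isEnumeration zero    = record
  { unique = All.[] ∷ [] ; complete = λ { [] → here refl } }
allSubsets-isEnumeration (suc m) =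
  subst IsEnumeration (sym (concatMap-map≡cartesianProductWith cons (allSubsets m) bools))
    (cartesianProductWith-isEnumeration cons cons-injective cons-surjective
      (allSubsets-isEnumeration m) bools-isEnumeration)
  where
  cons : Subset m → Bool → Subset (suc m)
  cons A b = b ∷ A
  cons-injective : ∀ {A B a b} → cons A a ≡ cons B b → A ≡ B × a ≡ b
  cons-injective eq with ∷-injective eq
  ... | a≡b , A≡B = A≡B , a≡b
  cons-surjective : ∀ F → ∃₂ λ A b → cons A b ≡ F
  cons-surjective (b ∷ A) = A , b , refl

length-allCorners : ∀ m → length (allCorners m) ≡ 4 * m
length-allCorners m = trans (blocks (allFin m)) (cong (4 *_) (length-tabulate {n = m} (λ e → e)))
  where
  blocks : (es : List (Fin m)) → length (concatMap (λ e → map (e ,_) bitPairs) es) ≡ 4 * length es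
  blocks []       = refl
  blocks (e ∷ es) = trans (cong (4 +_) (blocks es)) (sym (*-suc 4 (length es)))

bit : Bool → Fin 2
bit false = zero
bit true  = suc zero

bit-injective : ∀ {a b} → bit a ≡ bit b → a ≡ b
bit-injective {false} {false} _ = refl
bit-injective {true}  {true}  _ = refl

cornerIndex : ∀ {m} → Corner m → Fin (m * 4)
cornerIndex (e , s , c) = combine e (combine (bit s) (bit c))

toℕ-cornerIndex : ∀ {m} (p : Corner m) → toℕ (cornerIndex p) ≡ rank p
toℕ-cornerIndex (e , s , c) = begin
  toℕ (combine e (combine (bit s) (bit c)))  ≡⟨ toℕ-combine e _ ⟩
  4 * toℕ e + toℕ (combine (bit s) (bit c))  ≡⟨ cong (4 * toℕ e +_) (toℕ-bits s c) ⟩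
  4 * toℕ e + (2 * b2n s + b2n c)            ≡⟨ +-assoc (4 * toℕ e) _ _ ⟨
  rank (e , s , c)                           ∎
  where
  open ≡-Reasoning
  toℕ-bits : ∀ s c → toℕ (combine (bit s) (bit c)) ≡ 2 * b2n s + b2n c
  toℕ-bits false false = refl
  toℕ-bits false true  = refl
  toℕ-bits true  false = refl
  toℕ-bits true  true  = refl

rank-injective : ∀ {m} → Injective _≡_ _≡_ (rank {m})
rank-injective {x = p@(e , s , c)} {q@(e′ , s′ , c′)} eq
  with combine-injective e _ e′ _
         (toℕ-injective (trans (toℕ-cornerIndex p) (trans eq (sym (toℕ-cornerIndex q)))))
... | refl , bits≡ with combine-injective (bit s) (bit c) (bit s′) (bit c′) bits≡
... | s≡s′ , c≡c′ = cong₂ (λ s c → e , s , c) (bit-injective s≡s′) (bit-injective c≡c′)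

β-involutive : ∀ {m} (F : Subset m) q → β F (β F q) ≡ q
β-involutive F (e , s , c) with e ∈ᵇ F in e∈F
... | true  rewrite e∈F | not-involutive s = refl
... | false rewrite e∈F | not-involutive c = refl

module BoundaryCycles (G : RibbonGraph) (F : EdgeSet G) where
  open IsEnumeration (allCorners-isEnumeration (edges G))
  private
    C = Corner (edges G)
    N = 4 * edges G
    corners = allCorners (edges G)

  reach-weaken : ∀ {p j q} → T (reach G F p j q) → T (reach G F p (suc j) q)
  reach-weaken {p} {j} {q} h = T-∨ˡ (reach G F p j q) h

  reach-α : ∀ {p j q} → T (reach G F p j (α G q)) → T (reach G F p (suc j) q)
  reach-α {p} {j} {q} h = T-∨ʳ (reach G F p j q) (T-∨ˡ (reach G F p j (α G q)) h)

  reach-β : ∀ {p j q} → T (reach G F p j (β F q)) → T (reach G F p (suc j) q)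
  reach-β {p} {j} {q} h = T-∨ʳ (reach G F p j q) (T-∨ʳ (reach G F p j (α G q)) h)

  reach-refl : ∀ p → T (reach G F p 0 p)
  reach-refl p = T-does⁺ (p ≟c p) refl

  reach-zero : ∀ {p q} → T (reach G F p 0 q) → q ≡ p
  reach-zero {p} {q} = T-does⁻ (q ≟c p)

  reach-+ : ∀ {p j q} k → T (reach G F p j q) → T (reach G F p (k + j) q)
  reach-+         zero    h = h
  reach-+ {p} {j} {q} (suc k) h = reach-weaken {p} {k + j} {q} (reach-+ k h)

  reach-trans : ∀ {p j q} k {x} →
    T (reach G F p j q) → T (reach G F q k x) → T (reach G F p (k + j) x)
  reach-trans {q = q} zero {x} pq qx with reach-zero {q} {x} qx
  ... | refl = pq
  reach-trans {p} {j} (suc k) {x} pq qx with to T-∨ qx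
  ... | inj₁ h = reach-weaken {p} {k + j} {x} (reach-trans k pq h)
  ... | inj₂ h with to T-∨ h
  ...   | inj₁ h′ = reach-α {p} {k + j} {x} (reach-trans k pq h′)
  ...   | inj₂ h′ = reach-β {p} {k + j} {x} (reach-trans k pq h′)

  reach-cons : ∀ {p q} j {x} →
    T (reach G F p 1 q) → T (reach G F q j x) → T (reach G F p (suc j) x)
  reach-cons {p} j {x} pq qx = subst (λ k → T (reach G F p k x)) (+-comm j 1) (reach-trans j pq qx)

  reach-α-once : ∀ q → T (reach G F q 1 (α G q))
  reach-α-once q = reach-α {q} {0} {α G q} (T-does⁺ (α G (α G q) ≟c q) (α-invol G q))

  reach-β-once : ∀ q → T (reach G F q 1 (β F q))
  reach-β-once q = reach-β {q} {0} {β F q} (T-does⁺ (β F (β F q) ≟c q) (β-involutive F q))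

  reach-sym : ∀ {p q} j → T (reach G F p j q) → T (reach G F q j p)
  reach-sym {p} {q} zero pq with reach-zero {p} {q} pq
  ... | refl = pq
  reach-sym {p} {q} (suc j) pq with to T-∨ pq
  ... | inj₁ h = reach-weaken {q} {j} {p} (reach-sym j h)
  ... | inj₂ h with to T-∨ h
  ...   | inj₁ h′ = reach-cons j (reach-α-once q) (reach-sym j h′)
  ...   | inj₂ h′ = reach-cons j (reach-β-once q) (reach-sym j h′)

  Stable : C → ℕ → Set
  Stable p j = ∀ q → reach G F p (suc j) q ≡ reach G F p j q

  stable-suc : ∀ {p j} → Stable p j → Stable p (suc j)
  stable-suc s q = cong₂ _∨_ (s q) (cong₂ _∨_ (s (α G q)) (s (β F q)))

  -- Pigeonhole: until it is stable the reachable set gains a corner at every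
  -- step, and there are only 4 m corners.
  grows-or-stable : ∀ p k → suc k ≤ count (reach G F p k) corners ⊎ Stable p k
  grows-or-stable p zero = inj₁ (≤-reflexive (sym
    (count-unique {g = reach G F p 0} unique (complete p) (reach-refl p) (reach-zero {p}))))
  grows-or-stable p (suc k) with grows-or-stable p k
  ... | inj₂ s = inj₂ (stable-suc {p} {k} s)
  ... | inj₁ k<c with count (reach G F p (suc k)) corners ≤? count (reach G F p k) corners
  ...   | no growth = inj₁ (≤-trans (s≤s k<c) (≰⇒> growth))
  ...   | yes no-growth =
          inj₂ (stable-suc {p} {k} λ q → T-⇔⇒≡ (shrink (complete q)) (reach-weaken {p} {k} {q}))
    where
    shrink : ∀ {q} → q ∈ corners → T (reach G F p (suc k) q) → T (reach G F p k q)
    shrink = count-reflects-⊆ {g = reach G F p k} {h = reach G F p (suc k)}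
      (λ {q} → reach-weaken {p} {k} {q}) corners no-growth

  stable-N : ∀ p → Stable p N
  stable-N p with grows-or-stable p N
  ... | inj₂ s = s
  ... | inj₁ N<c = ⊥-elim (<-irrefl refl (≤-trans N<c (≤-trans
          (count-≤-length (reach G F p N) corners) (≤-reflexive (length-allCorners (edges G))))))

  reach-stable : ∀ {p q} k → reach G F p (k + N) q ≡ reach G F p N q
  reach-stable zero    = refl
  reach-stable {p} {q} (suc k) = trans (stable-+ k q) (reach-stable k)
    where
    stable-+ : ∀ k → Stable p (k + N)
    stable-+ zero    = stable-N p
    stable-+ (suc k) = stable-suc {p} {k + N} (stable-+ k)

  reach-within-N : ∀ {p q} j → T (reach G F p j q) → T (reach G F p N q)
  reach-within-N {p} {q} j h = subst T (reach-stable j)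
    (subst (λ k → T (reach G F p k q)) (+-comm N j) (reach-+ N h))

  SameCycle : C → C → Bool
  SameCycle p q = reach G F p N q

  sameCycle-refl : ∀ p → T (SameCycle p p)
  sameCycle-refl p = reach-within-N 0 (reach-refl p)

  sameCycle-trans : ∀ {p q x} → T (SameCycle p q) → T (SameCycle q x) → T (SameCycle p x)
  sameCycle-trans pq qx = reach-within-N (N + N) (reach-trans N pq qx)

  -- With these, isRep G F is definitionally isClassMin rank.
  open ClassMinima (allCorners-isEnumeration (edges G)) SameCycle
    sameCycle-refl (reach-sym N) sameCycle-trans public

_∆_ : ∀ {m} → Subset m → Subset m → Subset m
F ∆ A = zipWith _xor_ F A

∆-involutive : ∀ {m} (A F : Subset m) → (F ∆ A) ∆ A ≡ F
∆-involutive []      []      = refl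
∆-involutive (a ∷ A) (x ∷ F) = cong₂ _∷_ xor-cancel (∆-involutive A F)
  where
  xor-cancel : (x xor a) xor a ≡ x
  xor-cancel = trans (xor-assoc x a a) (trans (cong (x xor_) (xor-same a)) (xor-identityʳ x))

π-injective : ∀ {m} (A : Subset m) → Injective _≡_ _≡_ (π A)
π-injective A {p} {q} πp≡πq = trans (sym (π-invol A p)) (trans (cong (π A) πp≡πq) (π-invol A q))

-- On a ribbon e ∈ A, π A swaps long sides with attaching segments while
-- e ∈ F ∆ A exactly when e ∉ F, so both sides pick corresponding pieces.
β-∆-π : ∀ {m} (F A : Subset m) q → β (F ∆ A) (π A q) ≡ π A (β F q)
β-∆-π F A (e , s , c) with e ∈ᵇ A in e∈A | e ∈ᵇ F in e∈F
... | true  | true  rewrite lookup-zipWith _xor_ e F A | e∈A | e∈F = refl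
... | true  | false rewrite lookup-zipWith _xor_ e F A | e∈A | e∈F = refl
... | false | true  rewrite lookup-zipWith _xor_ e F A | e∈A | e∈F = refl
... | false | false rewrite lookup-zipWith _xor_ e F A | e∈A | e∈F = refl

module _ (G : RibbonGraph) (A F : EdgeSet G) where
  private
    G′ = G ^δ A
    F′ = F ∆ A
    corners = allCorners (edges G)

  reach-partialDual : ∀ j p q → reach G′ F′ (π A p) j (π A q) ≡ reach G F p j q
  reach-partialDual zero    p q =
    T-⇔⇒≡ (T-does⁺ (q ≟c p) ∘ π-injective A ∘ T-does⁻ (π A q ≟c π A p))
          (T-does⁺ (π A q ≟c π A p) ∘ cong (π A) ∘ T-does⁻ (q ≟c p))
  reach-partialDual (suc j) p q = cong₂ _∨_ (reach-partialDual j p q) (cong₂ _∨_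
    (trans (cong (λ x → reach G′ F′ (π A p) j (π A (α G x))) (π-invol A q))
           (reach-partialDual j p (α G q)))
    (trans (cong (reach G′ F′ (π A p) j) (β-∆-π F A q))
           (reach-partialDual j p (β F q))))

  open BoundaryCycles G F using (isClassMin; count-classMin-independent)

  isRep-partialDual : ∀ p → isRep G′ F′ (π A p) ≡ isClassMin (rank ∘ π A) p
  isRep-partialDual p = cong not (begin
    any (λ q → reach G′ F′ (π A p) N q ∧ (rank q <ᵇ rank (π A p))) corners
      ≡⟨ any-∘-involution _≟c_ (allCorners-isEnumeration _) (π A) (π-invol A) _ ⟨
    any (λ q → reach G′ F′ (π A p) N (π A q) ∧ (rank (π A q) <ᵇ rank (π A p))) corners
      ≡⟨ any-cong corners (λ q → cong (_∧ _) (reach-partialDual N p q)) ⟩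
    any (λ q → reach G F p N q ∧ (rank (π A q) <ᵇ rank (π A p))) corners ∎)
    where
    open ≡-Reasoning
    N = 4 * edges G

  bc-partialDual : bc G F ≡ bc G′ F′
  bc-partialDual = cong (isolated G +_) (begin
    length (filterᵇ (isRep G F) corners)
      ≡⟨ length-filterᵇ (isRep G F) corners ⟩
    count (isClassMin rank) corners
      ≡⟨ count-classMin-independent rank-injective (π-injective A ∘ rank-injective) ⟩
    count (isClassMin (rank ∘ π A)) corners
      ≡⟨ count-cong corners isRep-partialDual ⟨
    count (isRep G′ F′ ∘ π A) corners
      ≡⟨ count-∘-involution _≟c_ (allCorners-isEnumeration _) (π A) (π-invol A) (isRep G′ F′) ⟩
    count (isRep G′ F′) corners
      ≡⟨ length-filterᵇ (isRep G′ F′) corners ⟨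
    length (filterᵇ (isRep G′ F′) corners) ∎)
    where open ≡-Reasoning

f-partialDual : ∀ (G : RibbonGraph) (A : EdgeSet G) n → f n G ≡ f n (G ^δ A)
f-partialDual G A n = begin
  length (filterᵇ (λ F → bc G F ≡ᵇ n) subsets)
    ≡⟨ length-filterᵇ _ subsets ⟩
  count (λ F → bc G F ≡ᵇ n) subsets
    ≡⟨ count-cong subsets bc-preserved ⟩
  count (λ F → bc G′ (F ∆ A) ≡ᵇ n) subsets
    ≡⟨ count-∘-involution (Vec.≡-dec Bool._≟_) (allSubsets-isEnumeration _) (_∆ A) (∆-involutive A) _ ⟩
  count (λ F → bc G′ F ≡ᵇ n) subsets
    ≡⟨ length-filterᵇ _ subsets ⟨
  length (filterᵇ (λ F → bc G′ F ≡ᵇ n) subsets) ∎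
  where
  open ≡-Reasoning
  G′ = G ^δ A
  subsets = allSubsets (edges G)
  bc-preserved : ∀ F → (bc G F ≡ᵇ n) ≡ (bc G′ (F ∆ A) ≡ᵇ n)
  bc-preserved F = cong (_≡ᵇ n) (bc-partialDual G A F)

-- The identity holds for every n.
corollary5p7 : (G : RibbonGraph) (A : EdgeSet G) →
    ((n : ℕ) → 1 ≤ n → f n G ≡ f n (G ^δ A)) × (κ G ≡ κ (G ^δ A))
corollary5p7 G A = (λ n _ → f-partialDual G A n) , f-partialDual G A 1
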